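{- For all positive integers $k$ and $t$ with $k$ even and $t\ge 3$, we have $M(k,t,3)>2^{kt/4}$.
   Context: A triangle is rainbow if its three edges receive distinct colors; a copy of $K_t$ is monochromatic if all its edges receive the same color. $M(k,t,s)$ denotes the minimum positive integer $n$ such that every edge-coloring of $K_n$ with $k$ colors contains a monochromatic $K_t$ or a rainbow $K_s$ (a copy of $K_s$ with all $\binom{s}{2}$ edges of distinct colors). -}

module Defs where

open import Data.Nat using (ℕ; _≤_; _<_; _*_; _^_; _/_)
open import Data.Fin using (Fin)
open import Data.Product using (Σ; _×_)
open import Data.Sum using (_⊎_)
open import Relation.Nullary using (¬_)
open import Relation.Binary.PropositionalEquality using (_≡_; _≢_)
open import Function.Definitions using (Injective)

-- An edge-colouring of K_n with k colours: a symmetric map on pairs of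
-- vertices (the diagonal values are irrelevant and never inspected).
record Colouring (k n : ℕ) : Set where
  field
    col  : Fin n → Fin n → Fin k
    symm : ∀ i j → col i j ≡ col j i
open Colouring public

record Copy (t n : ℕ) : Set where
  field
    emb : Fin t → Fin n
    inj : Injective _≡_ _≡_ emb
open Copy public

Monochromatic : ∀ {k n t} → Colouring k n → Copy t n → Set
Monochromatic {k} {t = t} c f =
  Σ (Fin k) λ a → ∀ (i j : Fin t) → i ≢ j → col c (emb f i) (emb f j) ≡ a

Rainbow : ∀ {k n s} → Colouring k n → Copy s n → Set
Rainbow {s = s} c f =
  ∀ (i j l m : Fin s) → i ≢ j → l ≢ m →
    col c (emb f i) (emb f j) ≡ col c (emb f l) (emb f m) →
    (i ≡ l × j ≡ m) ⊎ (i ≡ m × j ≡ l)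

Arrows : ℕ → ℕ → ℕ → ℕ → Set
Arrows k t s n = (c : Colouring k n) →
  Σ (Copy t n) (Monochromatic c) ⊎ Σ (Copy s n) (Rainbow c)

IsM : ℕ → ℕ → ℕ → ℕ → Set
IsM k t s n = 1 ≤ n × Arrows k t s n × (∀ m → 1 ≤ m → m < n → ¬ Arrows k t s m)

module Submission where

-- Write k = 2r.  Erdős's double counting shows that for t ≥ 3 some n with
-- 2^t ≤ n² admits a 2-colouring of K_n without monochromatic K_t (only in the
-- negative form "not every 2-colouring has one", as the argument is by
-- counting).  Its lexicographic r-th power colours K_(n^r) with 2r colours: two
-- words get the pair (level, colour) of the first position where they differ.
-- A monochromatic clique of the power shares its first letter and descends, or
-- has distinct first letters coloured monochromatically by the original; among
-- three words two pairs first differ at the same position, so no triangle is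
-- rainbow.  Hence M(2r,t,3) > n^r, and M² > n^(2r) ≥ 2^(rt).

open import Defs
open import Data.Bool using (Bool; true; false; if_then_else_) renaming (_≟_ to _≟ᵇ_)
open import Data.Fin using (Fin; zero; suc; inject≤; fromℕ<; combine; quotient; remainder)
open import Data.Fin.Patterns using (0F; 1F; 2F)
open import Data.Fin.Properties
  using (inject≤-injective; fromℕ<-injective; combine-injective; combine-remQuot; 2↔Bool)
  renaming (_≟_ to _≟ᶠ_; suc-injective to fsuc-injective)
open import Data.Fin.Subset using (Subset; inside; outside; _∈_; _⊆_; ∣_∣; ⊥; ⁅_⁆; _∪_)
open import Data.Fin.Subset.Properties
  using ( ∉⊥; ⊥⊆; ∣⊥∣≡0; x∈⁅x⁆; x∈⁅y⁆⇒x≡y; x∈p∪q⁻; x∈p∪q⁺; q⊆p∪q; p⊂q⇒∣p∣<∣q∣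
        ; out⊆; in⊆in)
open import Data.Nat
open import Data.Nat.Combinatorics using (_C_; nC1≡n; nCk+nC[k+1]≡[n+1]C[k+1])
open import Data.Nat.DivMod using (m*n/n≡m)
open import Data.Nat.Divisibility using (_∣_; divides)
open import Data.Nat.Properties
open import Algebra.Properties.CommutativeSemigroup +-commutativeSemigroup
  using () renaming (interchange to +-interchange)
open import Algebra.Properties.CommutativeSemigroup *-commutativeSemigroup
  using (x∙yz≈y∙xz)
open import Data.Nat.Tactic.RingSolver using (solve-∀)
open import Data.Product as Product using (Σ; ∃; _×_; _,_; proj₁; proj₂)
open import Data.Sum as Sum using (_⊎_; inj₁; inj₂; [_,_]′)
open import Data.Unit using (⊤; tt)
open import Data.Vec using (Vec; []; _∷_; head; tail; lookup; here; there)
open import Data.Vec.Properties using (∷-injectiveˡ; ∷-injectiveʳ)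
open import Function using (_∘_; id; Inverse)
open import Function.Definitions using (Injective)
open import Relation.Nullary using (¬_; Dec; does; yes; no; contradiction)
open import Relation.Nullary.Decidable using (dec-true)
open import Relation.Binary.PropositionalEquality

RamseyArrow : ℕ → ℕ → ℕ → Set
RamseyArrow k t n = (c : Colouring k n) → Σ (Copy t n) (Monochromatic c)

module _ {m n : ℕ} (m≤n : m ≤ n) where

  restrict : ∀ {k} → Colouring k n → Colouring k m
  restrict c = record
    { col  = λ i j → col c (inject≤ i m≤n) (inject≤ j m≤n)
    ; symm = λ i j → symm c _ _
    }

  extend : ∀ {t} → Copy t m → Copy t n
  extend f = record
    { emb = λ i → inject≤ (emb f i) m≤n
    ; inj = inj f ∘ inject≤-injective m≤n m≤n _ _
    }

  Arrows-mono : ∀ {k t s} → Arrows k t s m → Arrows k t s n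
  Arrows-mono arrows c =
    Sum.map (Product.map extend id) (Product.map extend id) (arrows (restrict c))

¬Arrows⇒< : ∀ {k t s n M} → IsM k t s M → ¬ Arrows k t s n → n < M
¬Arrows⇒< (_ , arrows , _) ¬arrows = ≰⇒> (¬arrows ∘ λ M≤n → Arrows-mono M≤n arrows)

NotAllDistinct : ∀ {a} {A : Set a} → A → A → A → Set a
NotAllDistinct u v w = u ≡ v ⊎ u ≡ w ⊎ v ≡ w

NotAllDistinct-map : ∀ {a b} {A : Set a} {B : Set b} (f : A → B) {u v w : A} →
  NotAllDistinct u v w → NotAllDistinct (f u) (f v) (f w)
NotAllDistinct-map f = Sum.map (cong f) (Sum.map (cong f) (cong f))

Fin2-notAllDistinct : ∀ (u v w : Fin 2) → NotAllDistinct u v w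
Fin2-notAllDistinct 0F 0F _  = inj₁ refl
Fin2-notAllDistinct 1F 1F _  = inj₁ refl
Fin2-notAllDistinct 0F 1F 0F = inj₂ (inj₁ refl)
Fin2-notAllDistinct 0F 1F 1F = inj₂ (inj₂ refl)
Fin2-notAllDistinct 1F 0F 0F = inj₂ (inj₂ refl)
Fin2-notAllDistinct 1F 0F 1F = inj₂ (inj₁ refl)

Gallai : ∀ {k n} → Colouring k n → Set
Gallai {n = n} c = ∀ (x y z : Fin n) → x ≢ y → x ≢ z → y ≢ z →
  NotAllDistinct (col c x y) (col c x z) (col c y z)

Gallai⇒¬rainbow-triangle : ∀ {k n} (c : Colouring k n) → Gallai c → ¬ Σ (Copy 3 n) (Rainbow c)
Gallai⇒¬rainbow-triangle c gallai (f , rainbow)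
  with gallai (emb f 0F) (emb f 1F) (emb f 2F) ((λ ()) ∘ inj f) ((λ ()) ∘ inj f) ((λ ()) ∘ inj f)
... | inj₁ xy≡xz with rainbow 0F 1F 0F 2F (λ ()) (λ ()) xy≡xz
...   | inj₁ (_ , ())
...   | inj₂ (() , _)
Gallai⇒¬rainbow-triangle c gallai (f , rainbow) | inj₂ (inj₁ xy≡yz)
  with rainbow 0F 1F 1F 2F (λ ()) (λ ()) xy≡yz
...   | inj₁ (() , _)
...   | inj₂ (() , _)
Gallai⇒¬rainbow-triangle c gallai (f , rainbow) | inj₂ (inj₂ xz≡yz)
  with rainbow 0F 2F 1F 2F (λ ()) (λ ()) xz≡yz
...   | inj₁ (() , _)
...   | inj₂ (() , _)

-- Lexicographic powers

module LexicographicPower {n : ℕ} (c : Colouring 2 n) where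

  -- Two words are coloured by the number of letters after the first position
  -- where they differ, together with the c-colour of the two letters there;
  -- equal words get (0 , 0F).
  lexColour : ∀ {r} → Vec (Fin n) r → Vec (Fin n) r → ℕ × Fin 2
  lexColour [] [] = 0 , 0F
  lexColour {suc r} (a ∷ x) (b ∷ y) with a ≟ᶠ b
  ... | yes _ = lexColour x y
  ... | no  _ = r , col c a b

  lexColour-sym : ∀ {r} (x y : Vec (Fin n) r) → lexColour x y ≡ lexColour y x
  lexColour-sym [] [] = refl
  lexColour-sym {suc r} (a ∷ x) (b ∷ y) with a ≟ᶠ b | b ≟ᶠ a
  ... | yes _   | yes _   = lexColour-sym x y
  ... | yes a≡b | no b≢a  = contradiction (sym a≡b) b≢a
  ... | no a≢b  | yes b≡a = contradiction (sym b≡a) a≢b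
  ... | no _    | no _    = cong (r ,_) (symm c a b)

  lexColour-level≤ : ∀ {r} (x y : Vec (Fin n) (suc r)) → proj₁ (lexColour x y) ≤ r
  lexColour-level≤ (a ∷ x) (b ∷ y) with a ≟ᶠ b
  lexColour-level≤ (_ ∷ [])        (_ ∷ []) | yes _ = z≤n
  lexColour-level≤ (_ ∷ x@(_ ∷ _)) (_ ∷ y)  | yes _ = m≤n⇒m≤1+n (lexColour-level≤ x y)
  lexColour-level≤ _               _        | no _  = ≤-refl

  lexColour-level< : ∀ {r} {x y : Vec (Fin n) r} → x ≢ y → proj₁ (lexColour x y) < r
  lexColour-level< {x = []} {[]} []≢[] = contradiction refl []≢[]
  lexColour-level< {x = a ∷ x} {b ∷ y} a∷x≢b∷y with a ≟ᶠ b
  ... | yes refl = m<n⇒m<1+n (lexColour-level< (a∷x≢b∷y ∘ cong (a ∷_)))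
  ... | no _     = ≤-refl

  lexColour-gallai : ∀ {r} (x y z : Vec (Fin n) r) →
    NotAllDistinct (lexColour x y) (lexColour x z) (lexColour y z)
  lexColour-gallai [] [] [] = inj₁ refl
  lexColour-gallai {suc r} (a ∷ x) (b ∷ y) (d ∷ z) with a ≟ᶠ b | a ≟ᶠ d | b ≟ᶠ d
  ... | yes _   | yes _   | yes _   = lexColour-gallai x y z
  ... | yes a≡b | yes a≡d | no b≢d  = contradiction (trans (sym a≡b) a≡d) b≢d
  ... | yes a≡b | no a≢d  | yes b≡d = contradiction (trans a≡b b≡d) a≢d
  ... | no a≢b  | yes a≡d | yes b≡d = contradiction (trans a≡d (sym b≡d)) a≢b
  ... | yes a≡b | no _    | no _    = inj₂ (inj₂ (cong (λ e → r , col c e d) a≡b))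
  ... | no _    | yes a≡d | no _    =
    inj₂ (inj₁ (cong (r ,_) (trans (cong (λ e → col c e b) a≡d) (symm c d b))))
  ... | no _    | no _    | yes b≡d = inj₁ (cong (λ e → r , col c a e) b≡d)
  ... | no _    | no _    | no _    = NotAllDistinct-map (r ,_) (Fin2-notAllDistinct _ _ _)

  lexColour-same-head : ∀ {r} (x y : Vec (Fin n) (suc r)) → head x ≡ head y →
    lexColour x y ≡ lexColour (tail x) (tail y)
  lexColour-same-head (a ∷ _) (b ∷ _) a≡b with a ≟ᶠ b
  ... | yes _   = refl
  ... | no a≢b = contradiction a≡b a≢b

  lexColour-distinct-head : ∀ {r} (x y : Vec (Fin n) (suc r)) → head x ≢ head y →
    lexColour x y ≡ (r , col c (head x) (head y))
  lexColour-distinct-head (a ∷ _) (b ∷ _) a≢b with a ≟ᶠ b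
  ... | yes a≡b = contradiction a≡b a≢b
  ... | no _    = refl

  head-tail-injective : ∀ {r} {x y : Vec (Fin n) (suc r)} →
    head x ≡ head y → tail x ≡ tail y → x ≡ y
  head-tail-injective {x = _ ∷ _} {_ ∷ _} refl refl = refl

  lexColour-same-head-level< : ∀ {r} (x y : Vec (Fin n) (suc r)) → x ≢ y → head x ≡ head y →
    proj₁ (lexColour x y) < r
  lexColour-same-head-level< x y x≢y hx≡hy =
    subst (λ A → proj₁ A < _) (sym (lexColour-same-head x y hx≡hy))
      (lexColour-level< (x≢y ∘ head-tail-injective hx≡hy))

  lexColour-monochromatic : ∀ {t r} (f : Fin (2 + t) → Vec (Fin n) r) → Injective _≡_ _≡_ f →
    ∀ A → (∀ i j → i ≢ j → lexColour (f i) (f j) ≡ A) → Σ (Copy (2 + t) n) (Monochromatic c)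
  lexColour-monochromatic {r = zero} f f-inj A _ with f 0F | f 1F | f-inj {0F} {1F}
  ... | [] | [] | 0≡1 with () ← 0≡1 refl
  lexColour-monochromatic {t} {suc r} f f-inj A f-mono with head (f 0F) ≟ᶠ head (f 1F)
  ... | yes h₀≡h₁ = lexColour-monochromatic (tail ∘ f) tails-injective A tails-mono
    where
      distinct : ∀ {i j} → i ≢ j → f i ≢ f j
      distinct i≢j = i≢j ∘ f-inj

      A<r : proj₁ A < r
      A<r = subst (λ B → proj₁ B < r) (f-mono 0F 1F (λ ()))
        (lexColour-same-head-level< (f 0F) (f 1F) (distinct (λ ())) h₀≡h₁)

      heads-equal : ∀ i j → head (f i) ≡ head (f j)
      heads-equal i j with i ≟ᶠ j | head (f i) ≟ᶠ head (f j)
      ... | yes refl | _         = refl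
      ... | no _     | yes hi≡hj = hi≡hj
      ... | no i≢j   | no hi≢hj  = contradiction A<r (<-irrefl (cong proj₁
        (trans (sym (f-mono i j i≢j)) (lexColour-distinct-head (f i) (f j) hi≢hj))))

      tails-injective : Injective _≡_ _≡_ (tail ∘ f)
      tails-injective {i} {j} = f-inj ∘ head-tail-injective (heads-equal i j)

      tails-mono : ∀ i j → i ≢ j → lexColour (tail (f i)) (tail (f j)) ≡ A
      tails-mono i j i≢j =
        trans (sym (lexColour-same-head (f i) (f j) (heads-equal i j))) (f-mono i j i≢j)
  ... | no h₀≢h₁ = record { emb = head ∘ f ; inj = heads-injective } ,
                   col c (head (f 0F)) (head (f 1F)) , heads-mono
    where
      A≡ : A ≡ (r , col c (head (f 0F)) (head (f 1F)))
      A≡ = trans (sym (f-mono 0F 1F (λ ()))) (lexColour-distinct-head (f 0F) (f 1F) h₀≢h₁)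

      heads-distinct : ∀ {i j} → i ≢ j → head (f i) ≢ head (f j)
      heads-distinct {i} {j} i≢j hi≡hj = <-irrefl (cong proj₁ A≡) (subst (λ B → proj₁ B < r)
        (f-mono i j i≢j) (lexColour-same-head-level< (f i) (f j) (i≢j ∘ f-inj) hi≡hj))

      heads-injective : Injective _≡_ _≡_ (head ∘ f)
      heads-injective {i} {j} hi≡hj with i ≟ᶠ j
      ... | yes i≡j = i≡j
      ... | no i≢j  = contradiction hi≡hj (heads-distinct i≢j)

      heads-mono : ∀ i j → i ≢ j →
        col c (head (f i)) (head (f j)) ≡ col c (head (f 0F)) (head (f 1F))
      heads-mono i j i≢j = cong proj₂ (trans
        (sym (lexColour-distinct-head (f i) (f j) (heads-distinct i≢j))) (trans (f-mono i j i≢j) A≡))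

  digits : ∀ r → Fin (n ^ r) → Vec (Fin n) r
  digits zero    _ = []
  digits (suc r) x = quotient {n} (n ^ r) x ∷ digits r (remainder {n} (n ^ r) x)

  digits-injective : ∀ r → Injective _≡_ _≡_ (digits r)
  digits-injective zero    {0F} {0F} _ = refl
  digits-injective (suc r) {x}  {y}  dx≡dy = begin
    x                          ≡⟨ combine-remQuot {n} (n ^ r) x ⟨
    combine (quot x) (rem x)   ≡⟨ cong₂ combine (∷-injectiveˡ dx≡dy)
                                    (digits-injective r (∷-injectiveʳ dx≡dy)) ⟩
    combine (quot y) (rem y)   ≡⟨ combine-remQuot {n} (n ^ r) y ⟩
    y                          ∎
    where
      open ≡-Reasoning
      quot = quotient {n} (n ^ r)
      rem  = remainder {n} (n ^ r)

  -- Opaque so that r and A stay inferable from an application of encode.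
  opaque
    encode : ∀ {r} (A : ℕ × Fin 2) → .(proj₁ A ≤ r) → Fin (suc r * 2)
    encode (l , β) l≤r = combine (fromℕ< (s≤s l≤r)) β

    encode-cong : ∀ {r} {A B : ℕ × Fin 2} .{A≤r : proj₁ A ≤ r} .{B≤r : proj₁ B ≤ r} →
      A ≡ B → encode A A≤r ≡ encode B B≤r
    encode-cong refl = refl

    encode-injective : ∀ {r} {A B : ℕ × Fin 2} .{A≤r : proj₁ A ≤ r} .{B≤r : proj₁ B ≤ r} →
      encode A A≤r ≡ encode B B≤r → A ≡ B
    encode-injective {A = l , β} {m , γ} eq with combine-injective _ β _ γ eq
    ... | l≡m , β≡γ = cong₂ _,_ (fromℕ<-injective l m _ _ l≡m) β≡γ

  lexPower : ∀ r → Colouring (suc r * 2) (n ^ suc r)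
  lexPower r = record
    { col  = λ x y → encode (lexColour (word x) (word y)) (lexColour-level≤ (word x) (word y))
    ; symm = λ x y → encode-cong (lexColour-sym (word x) (word y))
    }
    where word = digits (suc r)

  lexPower-gallai : ∀ r → Gallai (lexPower r)
  lexPower-gallai r x y z _ _ _ = Sum.map encode-cong (Sum.map encode-cong encode-cong)
    (lexColour-gallai (digits (suc r) x) (digits (suc r) y) (digits (suc r) z))

  lexPower-monochromatic : ∀ {t r} → Σ (Copy (2 + t) (n ^ suc r)) (Monochromatic (lexPower r)) →
    Σ (Copy (2 + t) n) (Monochromatic c)
  lexPower-monochromatic {r = r} (f , a , f-mono) =
    lexColour-monochromatic (word ∘ emb f) (inj f ∘ digits-injective (suc r))
      (lexColour (word (emb f 0F)) (word (emb f 1F)))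
      λ i j i≢j → encode-injective (trans (f-mono i j i≢j) (sym (f-mono 0F 1F (λ ()))))
    where word = digits (suc r)

lexPower-arrows : ∀ {r t n} → 2 ≤ t → Arrows (suc r * 2) t 3 (n ^ suc r) → RamseyArrow 2 t n
lexPower-arrows {r} (s≤s (s≤s _)) arrows c =
  [ lexPower-monochromatic
  , (λ rainbow → contradiction rainbow (Gallai⇒¬rainbow-triangle (lexPower r) (lexPower-gallai r)))
  ]′ (arrows (lexPower r))
  where open LexicographicPower c

-- Subsets and the image of an injection

image : ∀ {t n} → (Fin t → Fin n) → Subset n
image {zero}  g = ⊥
image {suc t} g = ⁅ g zero ⁆ ∪ image (g ∘ suc)

∈-image⁺ : ∀ {t n} (g : Fin t → Fin n) i → g i ∈ image g
∈-image⁺ g zero    = x∈p∪q⁺ (inj₁ (x∈⁅x⁆ (g zero)))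
∈-image⁺ g (suc i) = x∈p∪q⁺ (inj₂ (∈-image⁺ (g ∘ suc) i))

∈-image⁻ : ∀ {t n} (g : Fin t → Fin n) {x} → x ∈ image g → ∃ λ i → g i ≡ x
∈-image⁻ {zero}  g x∈⊥ = contradiction x∈⊥ ∉⊥
∈-image⁻ {suc t} g x∈g with x∈p∪q⁻ ⁅ g zero ⁆ (image (g ∘ suc)) x∈g
... | inj₁ x∈⁅g0⁆ = zero , sym (x∈⁅y⁆⇒x≡y (g zero) x∈⁅g0⁆)
... | inj₂ x∈g∘suc = Product.map suc id (∈-image⁻ (g ∘ suc) x∈g∘suc)

image-size : ∀ {t n} (g : Fin t → Fin n) → Injective _≡_ _≡_ g → t ≤ ∣ image g ∣
image-size {zero}  g _     = z≤n
image-size {suc t} g g-inj = ≤-<-trans (image-size (g ∘ suc) (fsuc-injective ∘ g-inj))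
  (p⊂q⇒∣p∣<∣q∣ (q⊆p∪q ⁅ g zero ⁆ _ , g zero , ∈-image⁺ g zero , g0∉g∘suc))
  where
    g0∉g∘suc : ¬ g zero ∈ image (g ∘ suc)
    g0∉g∘suc g0∈ with ∈-image⁻ (g ∘ suc) g0∈
    ... | i , gsi≡g0 with () ← g-inj gsi≡g0

⊆-of-size : ∀ {n t} (p : Subset n) → t ≤ ∣ p ∣ → Σ (Subset n) λ q → q ⊆ p × ∣ q ∣ ≡ t
⊆-of-size {n} {zero}  p             _           = ⊥ , ⊥⊆ , ∣⊥∣≡0 n
⊆-of-size {t = suc t} (outside ∷ p) t<∣p∣       with ⊆-of-size p t<∣p∣
... | q , q⊆p , ∣q∣≡t = outside ∷ q , out⊆ q⊆p , ∣q∣≡t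
⊆-of-size {t = suc t} (inside ∷ p)  (s≤s t≤∣p∣) with ⊆-of-size p t≤∣p∣
... | q , q⊆p , ∣q∣≡t = inside ∷ q , in⊆in q⊆p , cong suc ∣q∣≡t

-- Erdős's bound for the diagonal Ramsey numbers

𝟙 : ∀ {p} {P : Set p} → Dec P → ℕ
𝟙 P? = if does P? then 1 else 0

𝟙-yes : ∀ {p} {P : Set p} (P? : Dec P) → P → 𝟙 P? ≡ 1
𝟙-yes P? p = cong (λ b → if b then 1 else 0) (dec-true P? p)

𝟙-*-cong : ∀ {p} {P : Set p} (P? : Dec P) {a b} → (P → a ≡ b) → 𝟙 P? * a ≡ 𝟙 P? * b
𝟙-*-cong (yes p) a≡b = cong (1 *_) (a≡b p)
𝟙-*-cong (no _)  _   = refl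

∑ᵛ : ∀ n → (Vec Bool n → ℕ) → ℕ
∑ᵛ zero    f = f []
∑ᵛ (suc n) f = ∑ᵛ n (f ∘ (false ∷_)) + ∑ᵛ n (f ∘ (true ∷_))

∑ᵛ-cong : ∀ n {f g : Vec Bool n → ℕ} → (∀ x → f x ≡ g x) → ∑ᵛ n f ≡ ∑ᵛ n g
∑ᵛ-cong zero    f≗g = f≗g []
∑ᵛ-cong (suc n) f≗g = cong₂ _+_ (∑ᵛ-cong n (f≗g ∘ (false ∷_))) (∑ᵛ-cong n (f≗g ∘ (true ∷_)))

∑ᵛ-+ : ∀ n (f g : Vec Bool n → ℕ) → ∑ᵛ n (λ x → f x + g x) ≡ ∑ᵛ n f + ∑ᵛ n g
∑ᵛ-+ zero    f g = refl
∑ᵛ-+ (suc n) f g = trans (cong₂ _+_ (∑ᵛ-+ n _ _) (∑ᵛ-+ n _ _))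
  (+-interchange (∑ᵛ n (f ∘ (false ∷_))) (∑ᵛ n (g ∘ (false ∷_)))
                 (∑ᵛ n (f ∘ (true ∷_)))  (∑ᵛ n (g ∘ (true ∷_))))

∑ᵛ-*ˡ : ∀ n a (f : Vec Bool n → ℕ) → ∑ᵛ n (λ x → a * f x) ≡ a * ∑ᵛ n f
∑ᵛ-*ˡ zero    a f = refl
∑ᵛ-*ˡ (suc n) a f =
  trans (cong₂ _+_ (∑ᵛ-*ˡ n a _) (∑ᵛ-*ˡ n a _)) (sym (*-distribˡ-+ a _ _))

∑ᵛ-const : ∀ n a → ∑ᵛ n (λ _ → a) ≡ 2 ^ n * a
∑ᵛ-const zero    a = sym (*-identityˡ a)
∑ᵛ-const (suc n) a = begin
  ∑ᵛ n (λ _ → a) + ∑ᵛ n (λ _ → a) ≡⟨ cong₂ _+_ (∑ᵛ-const n a) (∑ᵛ-const n a) ⟩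
  2 ^ n * a + 2 ^ n * a           ≡⟨ cong (2 ^ n * a +_) (+-identityʳ (2 ^ n * a)) ⟨
  2 * (2 ^ n * a)                 ≡⟨ *-assoc 2 (2 ^ n) a ⟨
  2 ^ suc n * a                   ∎
  where open ≡-Reasoning

∑ᵛ-mono-≤ : ∀ n {f g : Vec Bool n → ℕ} → (∀ x → f x ≤ g x) → ∑ᵛ n f ≤ ∑ᵛ n g
∑ᵛ-mono-≤ zero    f≤g = f≤g []
∑ᵛ-mono-≤ (suc n) f≤g = +-mono-≤ (∑ᵛ-mono-≤ n (f≤g ∘ (false ∷_))) (∑ᵛ-mono-≤ n (f≤g ∘ (true ∷_)))

≤-∑ᵛ : ∀ n (f : Vec Bool n → ℕ) x → f x ≤ ∑ᵛ n f
≤-∑ᵛ zero    f []          = ≤-refl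
≤-∑ᵛ (suc n) f (false ∷ x) = ≤-trans (≤-∑ᵛ n _ x) (m≤m+n _ _)
≤-∑ᵛ (suc n) f (true ∷ x)  = ≤-trans (≤-∑ᵛ n _ x) (m≤n+m _ _)

-- A 2-colouring of K_n stored as a triangular table: the colours of the
-- edges from vertex 0 to vertices 1..n-1, then a table for those vertices.
-- Unlike Colouring 2 n, each colouring has exactly one such table, so sums
-- over tables count colourings.
Bicolouring : ℕ → Set
Bicolouring zero    = ⊤
Bicolouring (suc n) = Vec Bool n × Bicolouring n

colourOf : ∀ {n} → Bicolouring n → Fin n → Fin n → Bool
colourOf (r , c) zero    zero    = false
colourOf (r , c) zero    (suc j) = lookup r j
colourOf (r , c) (suc i) zero    = lookup r i
colourOf (r , c) (suc i) (suc j) = colourOf c i j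

colourOf-sym : ∀ {n} (c : Bicolouring n) i j → colourOf c i j ≡ colourOf c j i
colourOf-sym (r , c) zero    zero    = refl
colourOf-sym (r , c) zero    (suc j) = refl
colourOf-sym (r , c) (suc i) zero    = refl
colourOf-sym (r , c) (suc i) (suc j) = colourOf-sym c i j

toColouring : ∀ {n} → Bicolouring n → Colouring 2 n
toColouring c = record
  { col  = λ i j → Inverse.from 2↔Bool (colourOf c i j)
  ; symm = λ i j → cong (Inverse.from 2↔Bool) (colourOf-sym c i j)
  }

∑ᶜ : ∀ n → (Bicolouring n → ℕ) → ℕ
∑ᶜ zero    f = f tt
∑ᶜ (suc n) f = ∑ᵛ n λ r → ∑ᶜ n λ c → f (r , c)

∑ᶜ-+ : ∀ n (f g : Bicolouring n → ℕ) → ∑ᶜ n (λ x → f x + g x) ≡ ∑ᶜ n f + ∑ᶜ n g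
∑ᶜ-+ zero    f g = refl
∑ᶜ-+ (suc n) f g = trans (∑ᵛ-cong n λ r → ∑ᶜ-+ n _ _) (∑ᵛ-+ n _ _)

∑ᶜ-*ˡ : ∀ n a (f : Bicolouring n → ℕ) → ∑ᶜ n (λ x → a * f x) ≡ a * ∑ᶜ n f
∑ᶜ-*ˡ zero    a f = refl
∑ᶜ-*ˡ (suc n) a f = trans (∑ᵛ-cong n λ r → ∑ᶜ-*ˡ n a _) (∑ᵛ-*ˡ n a _)

∑ᶜ-mono-≤ : ∀ n {f g : Bicolouring n → ℕ} → (∀ x → f x ≤ g x) → ∑ᶜ n f ≤ ∑ᶜ n g
∑ᶜ-mono-≤ zero    f≤g = f≤g tt
∑ᶜ-mono-≤ (suc n) f≤g = ∑ᵛ-mono-≤ n λ r → ∑ᶜ-mono-≤ n λ c → f≤g (r , c)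

∑ᵛ-∑ᶜ-comm : ∀ m n (F : Vec Bool m → Bicolouring n → ℕ) →
  ∑ᵛ m (λ x → ∑ᶜ n (F x)) ≡ ∑ᶜ n (λ c → ∑ᵛ m (λ x → F x c))
∑ᵛ-∑ᶜ-comm zero    n F = refl
∑ᵛ-∑ᶜ-comm (suc m) n F = trans
  (cong₂ _+_ (∑ᵛ-∑ᶜ-comm m n (F ∘ (false ∷_))) (∑ᵛ-∑ᶜ-comm m n (F ∘ (true ∷_))))
  (sym (∑ᶜ-+ n _ _))

C-suc-2 : ∀ n → suc n C 2 ≡ n + n C 2
C-suc-2 n = trans (sym (nCk+nC[k+1]≡[n+1]C[k+1] n 1)) (cong (_+ n C 2) (nC1≡n n))

2^C2-suc : ∀ n → 2 ^ n * 2 ^ (n C 2) ≡ 2 ^ (suc n C 2)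
2^C2-suc n = trans (sym (^-distribˡ-+-* 2 n (n C 2))) (cong (2 ^_) (sym (C-suc-2 n)))

∑ᶜ-1 : ∀ n → ∑ᶜ n (λ _ → 1) ≡ 2 ^ (n C 2)
∑ᶜ-1 zero    = refl
∑ᶜ-1 (suc n) = begin
  ∑ᵛ n (λ _ → ∑ᶜ n (λ _ → 1)) ≡⟨ ∑ᵛ-const n _ ⟩
  2 ^ n * ∑ᶜ n (λ _ → 1)      ≡⟨ cong (2 ^ n *_) (∑ᶜ-1 n) ⟩
  2 ^ n * 2 ^ (n C 2)         ≡⟨ 2^C2-suc n ⟩
  2 ^ (suc n C 2)             ∎
  where open ≡-Reasoning

-- 0/1-valued: whether the row r takes the value v on all of S, and whether
-- c colours every edge inside S with v.
rowAgrees : ∀ {n} → Bool → Subset n → Vec Bool n → ℕ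
rowAgrees v []            []      = 1
rowAgrees v (outside ∷ S) (_ ∷ r) = rowAgrees v S r
rowAgrees v (inside  ∷ S) (x ∷ r) = 𝟙 (x ≟ᵇ v) * rowAgrees v S r

monochromatic : ∀ {n} → Bool → Subset n → Bicolouring n → ℕ
monochromatic v []            tt      = 1
monochromatic v (outside ∷ S) (_ , c) = monochromatic v S c
monochromatic v (inside  ∷ S) (r , c) = rowAgrees v S r * monochromatic v S c

rowAgrees-count : ∀ {n} v (S : Subset n) → ∑ᵛ n (rowAgrees v S) * 2 ^ ∣ S ∣ ≡ 2 ^ n
rowAgrees-count v [] = refl
rowAgrees-count {suc n} v (outside ∷ S) = begin
  (X + X) * 2 ^ ∣ S ∣   ≡⟨ cong (λ y → (X + y) * 2 ^ ∣ S ∣) (+-identityʳ X) ⟨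
  (2 * X) * 2 ^ ∣ S ∣   ≡⟨ *-assoc 2 X _ ⟩
  2 * (X * 2 ^ ∣ S ∣)   ≡⟨ cong (2 *_) (rowAgrees-count v S) ⟩
  2 ^ suc n             ∎
  where
    open ≡-Reasoning
    X = ∑ᵛ n (rowAgrees v S)
rowAgrees-count {suc n} v (inside ∷ S) = begin
  (∑ᵛ n (λ r → 𝟙 (false ≟ᵇ v) * ρ r) + ∑ᵛ n (λ r → 𝟙 (true ≟ᵇ v) * ρ r)) * (2 * 2 ^ ∣ S ∣)
    ≡⟨ cong (_* (2 * 2 ^ ∣ S ∣))
         (cong₂ _+_ (∑ᵛ-*ˡ n (𝟙 (false ≟ᵇ v)) ρ) (∑ᵛ-*ˡ n (𝟙 (true ≟ᵇ v)) ρ)) ⟩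
  (𝟙 (false ≟ᵇ v) * X + 𝟙 (true ≟ᵇ v) * X) * (2 * 2 ^ ∣ S ∣)
    ≡⟨ cong (_* (2 * 2 ^ ∣ S ∣)) (exactly-one-agrees v) ⟩
  X * (2 * 2 ^ ∣ S ∣)  ≡⟨ x∙yz≈y∙xz X 2 _ ⟩
  2 * (X * 2 ^ ∣ S ∣)  ≡⟨ cong (2 *_) (rowAgrees-count v S) ⟩
  2 ^ suc n            ∎
  where
    open ≡-Reasoning
    ρ = rowAgrees v S
    X = ∑ᵛ n ρ
    exactly-one-agrees : ∀ v → 𝟙 (false ≟ᵇ v) * X + 𝟙 (true ≟ᵇ v) * X ≡ X
    exactly-one-agrees false = trans (+-identityʳ (1 * X)) (*-identityˡ X)
    exactly-one-agrees true  = *-identityˡ X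

monochromatic-count : ∀ {n} v (S : Subset n) →
  ∑ᶜ n (monochromatic v S) * 2 ^ (∣ S ∣ C 2) ≡ 2 ^ (n C 2)
monochromatic-count v [] = refl
monochromatic-count {suc n} v (outside ∷ S) = begin
  ∑ᵛ n (λ _ → Y) * 2 ^ (∣ S ∣ C 2) ≡⟨ cong (_* 2 ^ (∣ S ∣ C 2)) (∑ᵛ-const n Y) ⟩
  2 ^ n * Y * 2 ^ (∣ S ∣ C 2)      ≡⟨ *-assoc (2 ^ n) Y _ ⟩
  2 ^ n * (Y * 2 ^ (∣ S ∣ C 2))    ≡⟨ cong (2 ^ n *_) (monochromatic-count v S) ⟩
  2 ^ n * 2 ^ (n C 2)              ≡⟨ 2^C2-suc n ⟩
  2 ^ (suc n C 2)                  ∎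
  where
    open ≡-Reasoning
    Y = ∑ᶜ n (monochromatic v S)
monochromatic-count {suc n} v (inside ∷ S) = begin
  ∑ᵛ n (λ r → ∑ᶜ n (λ c → rowAgrees v S r * monochromatic v S c)) * 2 ^ (suc s C 2)
    ≡⟨ cong (_* 2 ^ (suc s C 2)) (∑ᵛ-cong n λ r → ∑ᶜ-*ˡ n (rowAgrees v S r) _) ⟩
  ∑ᵛ n (λ r → rowAgrees v S r * Y) * 2 ^ (suc s C 2)
    ≡⟨ cong (_* 2 ^ (suc s C 2)) (∑ᵛ-cong n λ r → *-comm (rowAgrees v S r) Y) ⟩
  ∑ᵛ n (λ r → Y * rowAgrees v S r) * 2 ^ (suc s C 2)
    ≡⟨ cong₂ _*_ (∑ᵛ-*ˡ n Y _) (sym (2^C2-suc s)) ⟩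
  Y * X * (2 ^ s * 2 ^ (s C 2))
    ≡⟨ regroup Y X (2 ^ s) (2 ^ (s C 2)) ⟩
  (X * 2 ^ s) * (Y * 2 ^ (s C 2))
    ≡⟨ cong₂ _*_ (rowAgrees-count v S) (monochromatic-count v S) ⟩
  2 ^ n * 2 ^ (n C 2)
    ≡⟨ 2^C2-suc n ⟩
  2 ^ (suc n C 2)                  ∎
  where
    open ≡-Reasoning
    s = ∣ S ∣
    X = ∑ᵛ n (rowAgrees v S)
    Y = ∑ᶜ n (monochromatic v S)
    regroup : ∀ a b c d → a * b * (c * d) ≡ (b * c) * (a * d)
    regroup = solve-∀

rowAgrees-≡1 : ∀ {n} v (S : Subset n) r →
  (∀ {y} → y ∈ S → lookup r y ≡ v) → rowAgrees v S r ≡ 1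
rowAgrees-≡1 v []            []      _       = refl
rowAgrees-≡1 v (outside ∷ S) (_ ∷ r) r≡v = rowAgrees-≡1 v S r (r≡v ∘ there)
rowAgrees-≡1 v (inside  ∷ S) (x ∷ r) r≡v =
  cong₂ _*_ (𝟙-yes (x ≟ᵇ v) (r≡v here)) (rowAgrees-≡1 v S r (r≡v ∘ there))

monochromatic-≡1 : ∀ {n} v (S : Subset n) c →
  (∀ {x y} → x ∈ S → y ∈ S → x ≢ y → colourOf c x y ≡ v) → monochromatic v S c ≡ 1
monochromatic-≡1 v []            tt      _    = refl
monochromatic-≡1 v (outside ∷ S) (_ , c) c≡v =
  monochromatic-≡1 v S c λ x∈S y∈S x≢y → c≡v (there x∈S) (there y∈S) (x≢y ∘ fsuc-injective)
monochromatic-≡1 v (inside  ∷ S) (r , c) c≡v = cong₂ _*_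
  (rowAgrees-≡1 v S r λ y∈S → c≡v here (there y∈S) λ ())
  (monochromatic-≡1 v S c λ x∈S y∈S x≢y → c≡v (there x∈S) (there y∈S) (x≢y ∘ fsuc-injective))

subsets-of-size : ∀ n t → ∑ᵛ n (λ S → 𝟙 (∣ S ∣ ≟ t)) ≡ n C t
subsets-of-size zero    zero    = refl
subsets-of-size zero    (suc t) = refl
subsets-of-size (suc n) zero    =
  cong₂ _+_ (subsets-of-size n 0) (trans (∑ᵛ-const n 0) (*-zeroʳ (2 ^ n)))
subsets-of-size (suc n) (suc t) = begin
  ∑ᵛ n (λ S → 𝟙 (∣ S ∣ ≟ suc t)) + ∑ᵛ n (λ S → 𝟙 (∣ S ∣ ≟ t))
    ≡⟨ cong₂ _+_ (subsets-of-size n (suc t)) (subsets-of-size n t) ⟩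
  n C suc t + n C t ≡⟨ +-comm (n C suc t) (n C t) ⟩
  n C t + n C suc t ≡⟨ nCk+nC[k+1]≡[n+1]C[k+1] n t ⟩
  suc n C suc t     ∎
  where open ≡-Reasoning

monochromaticSubsets : ∀ {n} → ℕ → Bicolouring n → ℕ
monochromaticSubsets {n} t c =
  ∑ᵛ n λ S → 𝟙 (∣ S ∣ ≟ t) * (monochromatic true S c + monochromatic false S c)

monochromaticSubsets-count : ∀ n t →
  2 ^ (t C 2) * ∑ᶜ n (monochromaticSubsets t) ≡ (2 * 2 ^ (n C 2)) * (n C t)
monochromaticSubsets-count n t = begin
  P * ∑ᶜ n (λ c → ∑ᵛ n λ S → 𝟙 (∣ S ∣ ≟ t) * (μ true S c + μ false S c))
    ≡⟨ cong (P *_) (∑ᵛ-∑ᶜ-comm n n _) ⟨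
  P * ∑ᵛ n (λ S → ∑ᶜ n λ c → 𝟙 (∣ S ∣ ≟ t) * (μ true S c + μ false S c))
    ≡⟨ cong (P *_) (∑ᵛ-cong n λ S →
         trans (∑ᶜ-*ˡ n (𝟙 (∣ S ∣ ≟ t)) _) (cong (𝟙 (∣ S ∣ ≟ t) *_) (∑ᶜ-+ n _ _))) ⟩
  P * ∑ᵛ n (λ S → 𝟙 (∣ S ∣ ≟ t) * (∑ᶜ n (μ true S) + ∑ᶜ n (μ false S)))
    ≡⟨ ∑ᵛ-*ˡ n P _ ⟨
  ∑ᵛ n (λ S → P * (𝟙 (∣ S ∣ ≟ t) * (∑ᶜ n (μ true S) + ∑ᶜ n (μ false S))))
    ≡⟨ ∑ᵛ-cong n per-subset ⟩
  ∑ᵛ n (λ S → K * 𝟙 (∣ S ∣ ≟ t)) ≡⟨ ∑ᵛ-*ˡ n K _ ⟩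
  K * ∑ᵛ n (λ S → 𝟙 (∣ S ∣ ≟ t)) ≡⟨ cong (K *_) (subsets-of-size n t) ⟩
  K * (n C t)                     ∎
  where
    open ≡-Reasoning
    μ = monochromatic
    P = 2 ^ (t C 2)
    K = 2 * 2 ^ (n C 2)
    W : Subset n → ℕ
    W S = ∑ᶜ n (μ true S) + ∑ᶜ n (μ false S)

    weight : ∀ S → 2 ^ (∣ S ∣ C 2) * W S ≡ K
    weight S = begin
      2 ^ (∣ S ∣ C 2) * W S
        ≡⟨ *-distribˡ-+ (2 ^ (∣ S ∣ C 2)) _ _ ⟩
      2 ^ (∣ S ∣ C 2) * ∑ᶜ n (μ true S) + 2 ^ (∣ S ∣ C 2) * ∑ᶜ n (μ false S)
        ≡⟨ cong₂ _+_ (trans (*-comm (2 ^ (∣ S ∣ C 2)) _) (monochromatic-count true S))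
                     (trans (*-comm (2 ^ (∣ S ∣ C 2)) _) (monochromatic-count false S)) ⟩
      2 ^ (n C 2) + 2 ^ (n C 2)             ≡⟨ cong (2 ^ (n C 2) +_) (+-identityʳ _) ⟨
      K                                     ∎

    per-subset : ∀ S → P * (𝟙 (∣ S ∣ ≟ t) * W S) ≡ K * 𝟙 (∣ S ∣ ≟ t)
    per-subset S = begin
      P * (𝟙 (∣ S ∣ ≟ t) * W S) ≡⟨ x∙yz≈y∙xz P (𝟙 (∣ S ∣ ≟ t)) (W S) ⟩
      𝟙 (∣ S ∣ ≟ t) * (P * W S) ≡⟨ 𝟙-*-cong (∣ S ∣ ≟ t) (λ ∣S∣≡t →
                                      subst (λ s → 2 ^ (s C 2) * W S ≡ K) ∣S∣≡t (weight S)) ⟩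
      𝟙 (∣ S ∣ ≟ t) * K         ≡⟨ *-comm (𝟙 (∣ S ∣ ≟ t)) K ⟩
      K * 𝟙 (∣ S ∣ ≟ t)         ∎

monochromaticSubsets-positive : ∀ {n t} → RamseyArrow 2 t n → ∀ c → 1 ≤ monochromaticSubsets t c
monochromaticSubsets-positive {n} {t} arrow c with arrow (toColouring c)
... | f , a , f-mono with ⊆-of-size (image (emb f)) (image-size (emb f) (inj f))
... | S , S⊆image , ∣S∣≡t = ≤-trans at-S (≤-∑ᵛ n _ S)
  where
    v = Inverse.to 2↔Bool a

    S-mono : ∀ {x y} → x ∈ S → y ∈ S → x ≢ y → colourOf c x y ≡ v
    S-mono x∈S y∈S x≢y with ∈-image⁻ (emb f) (S⊆image x∈S) | ∈-image⁻ (emb f) (S⊆image y∈S)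
    ... | i , refl | j , refl = trans (sym (Inverse.strictlyInverseˡ 2↔Bool _))
                                      (cong (Inverse.to 2↔Bool) (f-mono i j (x≢y ∘ cong (emb f))))

    some-colour : ∀ v → monochromatic v S c ≡ 1 →
      1 ≤ monochromatic true S c + monochromatic false S c
    some-colour true  μ≡1 = ≤-trans (≤-reflexive (sym μ≡1)) (m≤m+n _ _)
    some-colour false μ≡1 = ≤-trans (≤-reflexive (sym μ≡1)) (m≤n+m _ _)

    at-S : 1 ≤ 𝟙 (∣ S ∣ ≟ t) * (monochromatic true S c + monochromatic false S c)
    at-S = subst (λ i → 1 ≤ i * _) (sym (𝟙-yes (∣ S ∣ ≟ t) ∣S∣≡t))
      (≤-trans (some-colour v (monochromatic-≡1 v S c S-mono)) (≤-reflexive (sym (*-identityˡ _))))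

erdős : ∀ {n t} → 2 * (n C t) < 2 ^ (t C 2) → ¬ RamseyArrow 2 t n
erdős {n} {t} bound arrow = <⇒≱ bound (*-cancelʳ-≤ _ _ (2 ^ (n C 2)) {{m^n≢0 2 (n C 2)}} (begin
  2 ^ (t C 2) * 2 ^ (n C 2)                     ≡⟨ cong (2 ^ (t C 2) *_) (∑ᶜ-1 n) ⟨
  2 ^ (t C 2) * ∑ᶜ n (λ _ → 1)                  ≤⟨ *-monoʳ-≤ (2 ^ (t C 2))
                                                     (∑ᶜ-mono-≤ n (monochromaticSubsets-positive arrow)) ⟩
  2 ^ (t C 2) * ∑ᶜ n (monochromaticSubsets t)   ≡⟨ monochromaticSubsets-count n t ⟩
  (2 * 2 ^ (n C 2)) * (n C t)                   ≡⟨ regroup (2 ^ (n C 2)) (n C t) ⟩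
  2 * (n C t) * 2 ^ (n C 2)                     ∎))
  where
    open ≤-Reasoning
    regroup : ∀ a b → (2 * a) * b ≡ 2 * b * a
    regroup = solve-∀

-- Arithmetic

binomial-two-terms≤ : ∀ n t → n ^ suc t + suc t * n ^ t ≤ suc n ^ suc t
binomial-two-terms≤ n zero    = ≤-reflexive (expand n)
  where expand : ∀ n → n * 1 + 1 * 1 ≡ (1 + n) * 1
        expand = solve-∀
binomial-two-terms≤ n (suc t) = begin
  n ^ suc (suc t) + suc (suc t) * n ^ suc t
    ≤⟨ m≤m+n _ (suc t * n ^ t) ⟩
  n ^ suc (suc t) + suc (suc t) * n ^ suc t + suc t * n ^ t
    ≡⟨ expand n t (n ^ t) ⟨
  suc n * (n ^ suc t + suc t * n ^ t)
    ≤⟨ *-monoʳ-≤ (suc n) (binomial-two-terms≤ n t) ⟩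
  suc n ^ suc (suc t)
    ∎
  where
    open ≤-Reasoning
    expand : ∀ n t a →
      (1 + n) * (n * a + (1 + t) * a) ≡ n * (n * a) + (2 + t) * (n * a) + (1 + t) * a
    expand = solve-∀

C*!≤^ : ∀ n t → (n C t) * t ! ≤ n ^ t
C*!≤^ zero    zero    = ≤-refl
C*!≤^ zero    (suc t) = z≤n
C*!≤^ (suc n) zero    = ≤-refl
C*!≤^ (suc n) (suc t) = begin
  (suc n C suc t) * (suc t * t !)
    ≡⟨ cong (_* (suc t * t !)) (nCk+nC[k+1]≡[n+1]C[k+1] n t) ⟨
  (n C t + n C suc t) * (suc t * t !)
    ≡⟨ pascal-split (n C t) (n C suc t) (suc t) (t !) ⟩
  (n C suc t) * (suc t * t !) + suc t * ((n C t) * t !)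
    ≤⟨ +-mono-≤ (C*!≤^ n (suc t)) (*-monoʳ-≤ (suc t) (C*!≤^ n t)) ⟩
  n ^ suc t + suc t * n ^ t
    ≤⟨ binomial-two-terms≤ n t ⟩
  suc n ^ suc t
    ∎
  where
    open ≤-Reasoning
    pascal-split : ∀ a b s f → (a + b) * (s * f) ≡ b * (s * f) + s * (a * f)
    pascal-split = solve-∀

2*[1+t]C2 : ∀ t → 2 * (suc t C 2) ≡ suc t * t
2*[1+t]C2 zero    = refl
2*[1+t]C2 (suc t) = begin
  2 * (suc (suc t) C 2)      ≡⟨ cong (2 *_) (C-suc-2 (suc t)) ⟩
  2 * (suc t + suc t C 2)    ≡⟨ *-distribˡ-+ 2 (suc t) _ ⟩
  2 * suc t + 2 * (suc t C 2) ≡⟨ cong (2 * suc t +_) (2*[1+t]C2 t) ⟩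
  2 * suc t + suc t * t      ≡⟨ solve t ⟩
  suc (suc t) * suc t        ∎
  where
    open ≡-Reasoning
    solve : ∀ t → 2 * (1 + t) + (1 + t) * t ≡ (2 + t) * (1 + t)
    solve = solve-∀

≤⌈/2⌉+⌈/2⌉ : ∀ t → t ≤ ⌈ t /2⌉ + ⌈ t /2⌉
≤⌈/2⌉+⌈/2⌉ t = begin
  t                     ≡⟨ ⌊n/2⌋+⌈n/2⌉≡n t ⟨
  ⌊ t /2⌋ + ⌈ t /2⌉     ≤⟨ +-monoˡ-≤ ⌈ t /2⌉ (⌊n/2⌋≤⌈n/2⌉ t) ⟩
  ⌈ t /2⌉ + ⌈ t /2⌉     ∎
  where open ≤-Reasoning

⌈/2⌉+⌈/2⌉≤suc : ∀ t → ⌈ t /2⌉ + ⌈ t /2⌉ ≤ suc t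
⌈/2⌉+⌈/2⌉≤suc t = begin
  ⌈ t /2⌉ + ⌈ t /2⌉         ≤⟨ +-monoʳ-≤ ⌈ t /2⌉ (⌈n/2⌉-mono (n≤1+n t)) ⟩
  ⌊ suc t /2⌋ + ⌈ suc t /2⌉ ≡⟨ ⌊n/2⌋+⌈n/2⌉≡n (suc t) ⟩
  suc t                     ∎
  where open ≤-Reasoning

⌈/2⌉*≤C2 : ∀ t → ⌈ t /2⌉ * t ≤ suc t C 2
⌈/2⌉*≤C2 t = *-cancelˡ-≤ 2 (begin
  2 * (⌈ t /2⌉ * t)           ≡⟨ *-assoc 2 ⌈ t /2⌉ t ⟨
  (⌈ t /2⌉ + (⌈ t /2⌉ + 0)) * t ≡⟨ cong (λ a → (⌈ t /2⌉ + a) * t) (+-identityʳ ⌈ t /2⌉) ⟩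
  (⌈ t /2⌉ + ⌈ t /2⌉) * t      ≤⟨ *-monoˡ-≤ t (⌈/2⌉+⌈/2⌉≤suc t) ⟩
  suc t * t                   ≡⟨ 2*[1+t]C2 t ⟨
  2 * (suc t C 2)             ∎)
  where open ≤-Reasoning

2^[1+t]<t! : ∀ u → 2 ^ (6 + u) < (5 + u) !
2^[1+t]<t! zero    = ≤ᵇ⇒≤ 65 120 tt
2^[1+t]<t! (suc u) =
  <-≤-trans (*-monoʳ-< 2 (2^[1+t]<t! u)) (*-monoˡ-≤ ((5 + u) !) {2} {6 + u} (s≤s (s≤s z≤n)))

erdős-bound : ∀ t → 5 ≤ t → 2 * (2 ^ ⌈ t /2⌉ C t) < 2 ^ (t C 2)
erdős-bound t (s≤s (s≤s (s≤s (s≤s (s≤s (z≤n {u})))))) = *-cancelˡ-< (t !) _ _ (begin-strict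
  t ! * (2 * (n C t))             ≡⟨ regroup (t !) (n C t) ⟩
  2 * ((n C t) * t !)             ≤⟨ *-monoʳ-≤ 2 (C*!≤^ n t) ⟩
  2 * n ^ t                       ≡⟨ cong (2 *_) (^-*-assoc 2 ⌈ t /2⌉ t) ⟩
  2 * 2 ^ (⌈ t /2⌉ * t)           ≤⟨ *-monoʳ-≤ 2 (^-monoʳ-≤ 2 (⌈/2⌉*≤C2 t)) ⟩
  2 ^ suc (suc t C 2)             ≡⟨ cong (λ e → 2 ^ suc e) (C-suc-2 t) ⟩
  2 ^ (suc t + t C 2)             ≡⟨ ^-distribˡ-+-* 2 (suc t) (t C 2) ⟩
  2 ^ suc t * 2 ^ (t C 2)         <⟨ *-monoˡ-< (2 ^ (t C 2)) {{m^n≢0 2 (t C 2)}} (2^[1+t]<t! u) ⟩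
  t ! * 2 ^ (t C 2)               ∎)
  where
    open ≤-Reasoning
    n = 2 ^ ⌈ t /2⌉
    regroup : ∀ f c → f * (2 * c) ≡ 2 * (c * f)
    regroup = solve-∀

-- For t = 3 the choice n = 2^⌈t/2⌉ violates Erdős's condition, and for t = 4
-- it holds but 2^(t+1) < t! does not.
ramsey-lower-bound : ∀ t → 3 ≤ t → Σ ℕ λ n → 2 ^ t ≤ n * n × ¬ RamseyArrow 2 t n
ramsey-lower-bound 1 (s≤s ())
ramsey-lower-bound 2 (s≤s (s≤s ()))
ramsey-lower-bound 3 _ = 3 , ≤ᵇ⇒≤ 8 9 tt , erdős (≤ᵇ⇒≤ 3 8 tt)
ramsey-lower-bound 4 _ = 4 , ≤-refl , erdős (≤ᵇ⇒≤ 3 64 tt)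
ramsey-lower-bound t@(suc (suc (suc (suc (suc _))))) _ =
  2 ^ ⌈ t /2⌉ ,
  ≤-trans (^-monoʳ-≤ 2 (≤⌈/2⌉+⌈/2⌉ t)) (≤-reflexive (^-distribˡ-+-* 2 ⌈ t /2⌉ ⌈ t /2⌉)) ,
  erdős (erdős-bound t (s≤s (s≤s (s≤s (s≤s (s≤s z≤n))))))

^-distribʳ-* : ∀ m n k → (m * n) ^ k ≡ m ^ k * n ^ k
^-distribʳ-* m n zero    = refl
^-distribʳ-* m n (suc k) =
  trans (cong (m * n *_) (^-distribʳ-* m n k)) (regroup m n (m ^ k) (n ^ k))
  where regroup : ∀ a b c d → a * b * (c * d) ≡ a * c * (b * d)
        regroup = solve-∀

lemma3p3 : ∀ (k t : ℕ) → 1 ≤ k → 2 ∣ k → 3 ≤ t →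
    ∀ (M : ℕ) → IsM k t 3 M → 2 ^ ((k * t) / 2) < M * M
lemma3p3 .(suc r * 2) t _ (divides (suc r) refl) 3≤t M isM
  with n , 2^t≤n*n , ¬arrow ← ramsey-lower-bound t 3≤t = begin-strict
    2 ^ ((suc r * 2 * t) / 2)  ≡⟨ cong (λ e → 2 ^ (e / 2)) (regroup (suc r) t) ⟩
    2 ^ ((t * suc r * 2) / 2)  ≡⟨ cong (2 ^_) (m*n/n≡m (t * suc r) 2) ⟩
    2 ^ (t * suc r)            ≡⟨ ^-*-assoc 2 t (suc r) ⟨
    (2 ^ t) ^ suc r            ≤⟨ ^-monoˡ-≤ (suc r) 2^t≤n*n ⟩
    (n * n) ^ suc r            ≡⟨ ^-distribʳ-* n n (suc r) ⟩
    n ^ suc r * n ^ suc r      <⟨ *-mono-< n^r<M n^r<M ⟩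
    M * M                      ∎
  where
    open ≤-Reasoning
    regroup : ∀ r t → r * 2 * t ≡ t * r * 2
    regroup = solve-∀
    n^r<M : n ^ suc r < M
    n^r<M = ¬Arrows⇒< isM (¬arrow ∘ lexPower-arrows {r} (≤-trans (n≤1+n 2) 3≤t))
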